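{- For every $k\ge1$, with $d'=\lceil\log_2 k\rceil$, the amortized U-MMR proof size $\bar\sigma_{\mathrm{U\text{ - }MMR}}(k):=\lim_{N\to\infty}\frac1N\sum_{n=k}^{k+N-1}\sigma_{\mathrm{U\text{ - }MMR}}(k,n)$ exists and equals $$\bar\sigma_{\mathrm{U\text{ - }MMR}}(k)=d'+\frac{2k}{2^{d'}}-1=\log_2k+O(1).$$
   Context: A mountain of height $s\ge0$ is a perfect binary tree with $2^s$ leaves. The U-MMR with $n$ leaves is the ordered (left-to-right) list of mountains, one of height $i$ for each position $i$ at which the binary representation of $n$ has a 1-bit, arranged in decreasing order of height from left to right, whose leaves read left to right are $h_1,\dots,h_n$ (equivalently: each append adds a height-0 mountain at the right and immediately merges equal-height mountains repeatedly). $\sigma_{\mathrm{U\text{ - }MMR}}(k,n)$, for $1\le k\le n$, is the number of hashes in the membership proof of leaf $h_{n-k+1}$, which equals the height of the mountain containing $h_{n-k+1}$. -}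

module Defs where

open import Data.Nat as ℕ using (ℕ; zero; suc; _+_; _*_; _∸_; _^_; _≤ᵇ_)
open import Data.Nat.Properties using (_≟_; m^n≢0)
open import Data.Nat.Logarithm using (⌈log₂_⌉)
open import Data.Bool using (if_then_else_)
open import Data.List using (List; []; _∷_; reverse; map; upTo)
open import Data.Nat.ListAction using (sum)
open import Data.Integer using (+_)
open import Data.Rational using (ℚ; _/_; 0ℚ; 1ℚ; _-_; ∣_∣; _<_) renaming (_+_ to _+ℚ_)
open import Data.Product using (∃-syntax)
open import Relation.Nullary using (yes; no)

-- A U-MMR is represented by the list of its mountain heights.
-- Internally we keep the list right-to-left (rightmost mountain first),
-- so appending a leaf = pushing a height-0 mountain and merging equal heights.
push : ℕ → List ℕ → List ℕ
push h [] = h ∷ []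
push h (h' ∷ hs) with h ≟ h'
... | yes _ = push (suc h) hs
... | no _  = h ∷ h' ∷ hs

peaksRL : ℕ → List ℕ
peaksRL zero = []
peaksRL (suc n) = push 0 (peaksRL n)

mountains : ℕ → List ℕ
mountains n = reverse (peaksRL n)

-- height of the mountain containing the j-th leaf (1-based, left to right)
-- of the mountain list ms (left to right); 0 if out of range
leafMountainHeight : List ℕ → ℕ → ℕ
leafMountainHeight [] j = 0
leafMountainHeight (h ∷ hs) j =
  if j ≤ᵇ 2 ^ h then h else leafMountainHeight hs (j ∸ 2 ^ h)

-- σ_{U-MMR}(k,n): proof size for leaf h_{n-k+1} in the U-MMR with n leaves
σ : ℕ → ℕ → ℕ
σ k n = leafMountainHeight (mountains n) (n ∸ k + 1)

partialSum : ℕ → ℕ → ℕ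
partialSum k N = sum (map (λ i → σ k (k + i)) (upTo N))

-- (1/N) Σ_{n=k}^{k+N-1} σ(k,n)  (value at N = 0 is irrelevant, set to 0)
average : ℕ → ℕ → ℚ
average k zero = 0ℚ
average k (suc M) = (+ partialSum k (suc M)) / suc M

ConvergesTo : (ℕ → ℚ) → ℚ → Set
ConvergesTo a L = ∀ (ε : ℚ) → 0ℚ < ε → ∃[ N₀ ] (∀ N → N₀ ℕ.≤ N → ∣ a N - L ∣ < ε)

closedForm : ℕ → ℚ
closedForm k = ((+ d' / 1) +ℚ ((+ (2 * k)) / (2 ^ d')) {{m^n≢0 2 d'}}) - 1ℚ
  where d' = ⌈log₂ k ⌉

-- Counting mountains from the right, the k-th leaf from the right of the U-MMR with n
-- leaves lies in a mountain whose height is the number of levels i with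
-- n mod 2^(i+1) < k: the mountains are the 1-bits of n, and n mod 2^(i+1) is the number
-- of leaves in the mountains of height at most i. Summing over n = k, …, k+N-1 and
-- exchanging the sums, level i contributes N·min(k, 2^(i+1))/2^(i+1) up to an error k,
-- because its indicator is periodic with period 2^(i+1) and has k ⊓ 2^(i+1) hits per period.
-- Over the levels i < B = O(log (k+N)) the densities add up to
-- d' - 1 + 2k/2^d' - k/2^B, so the average differs from the limit by O(k log N / N).

module Submission where

open import Data.Bool.Base using (T; true; false)
open import Data.Empty using (⊥-elim)
open import Data.Integer.Base as ℤ using (+[1+_]; -[1+_]; _⊖_)
import Data.Integer.Properties as ℤ
import Data.Integer.Tactic.RingSolver as ℤ-Solver
open import Data.List.Base using (List; []; _∷_; [_]; _++_; map; reverse; applyUpTo)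
open import Data.List.Properties using (reverse-map; unfold-reverse)
open import Data.List.Relation.Binary.Permutation.Propositional.Properties using (↭-reverse)
open import Data.Nat.Base
  using (ℕ; zero; suc; _+_; _*_; _∸_; _^_; _≤_; _<_; _⊓_; _⊔_; ∣_-_∣; _≤ᵇ_; z≤n; s≤s; ⌊_/2⌋; ⌈_/2⌉; NonZero)
open import Data.Nat.DivMod
  using (_%_; _/_; n%1≡0; [m+n]%n≡m%n; m<n⇒m%n≡m; m≡m%n+[m/n]*n; m%n<n; %-congˡ; %-congʳ;
         [m*n+o]%[p*n]≡[m*n]%[p*n]+o; m%n*o≡m*o%[n*o])
open import Data.Nat.Induction using (<-wellFounded)
open import Data.Nat.ListAction using (sum)
open import Data.Nat.ListAction.Properties using (sum-↭)
open import Data.Nat.Logarithm using (⌈log₂_⌉; ⌈log₂⌉-mono-≤; ⌈log₂2^n⌉≡n)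
open import Data.Nat.Logarithm.Core using (⌈log2⌉)
open import Data.Nat.Properties
open import Data.Nat.Tactic.RingSolver using (solve-∀)
open import Data.Product.Base using (_×_; _,_; proj₁; ∃-syntax)
open import Data.Rational.Base as ℚ using (ℚ; mkℚ; toℚᵘ)
import Data.Rational.Properties as ℚ
open import Data.Rational.Unnormalised.Base as ℚᵘ using (mkℚᵘ; 1ℚᵘ)
import Data.Rational.Unnormalised.Properties as ℚᵘ
open import Function.Base using (_∘_; id)
open import Induction.WellFounded using (Acc; acc)
open import Relation.Binary.PropositionalEquality hiding ([_])
open import Relation.Nullary using (yes; no)

open import Defs

variable
  a b h j k l m n : ℕ
  f g : ℕ → ℕ
  hs : List ℕ

⌈2*m+n/2⌉≡m+⌈n/2⌉ : ∀ m n → ⌈ 2 * m + n /2⌉ ≡ m + ⌈ n /2⌉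
⌈2*m+n/2⌉≡m+⌈n/2⌉ zero    n = refl
⌈2*m+n/2⌉≡m+⌈n/2⌉ (suc m) n =
  trans (cong (λ x → ⌈ x + n /2⌉) (*-suc 2 m)) (cong suc (⌈2*m+n/2⌉≡m+⌈n/2⌉ m n))

n≤2*⌈n/2⌉ : ∀ n → n ≤ 2 * ⌈ n /2⌉
n≤2*⌈n/2⌉ n = begin
  n                          ≡⟨ ⌊n/2⌋+⌈n/2⌉≡n n ⟨
  ⌊ n /2⌋ + ⌈ n /2⌉          ≤⟨ +-monoˡ-≤ ⌈ n /2⌉ (⌊n/2⌋≤⌈n/2⌉ n) ⟩
  ⌈ n /2⌉ + ⌈ n /2⌉          ≡⟨ cong (⌈ n /2⌉ +_) (+-identityʳ ⌈ n /2⌉) ⟨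
  2 * ⌈ n /2⌉                ∎
  where open ≤-Reasoning

2*⌈n/2⌉≤1+n : ∀ n → 2 * ⌈ n /2⌉ ≤ suc n
2*⌈n/2⌉≤1+n n = begin
  2 * ⌈ n /2⌉                ≡⟨ cong (⌈ n /2⌉ +_) (+-identityʳ ⌈ n /2⌉) ⟩
  ⌈ n /2⌉ + ⌈ n /2⌉          ≤⟨ +-monoʳ-≤ ⌈ n /2⌉ (⌊n/2⌋≤⌈n/2⌉ (suc n)) ⟩
  ⌊ suc n /2⌋ + ⌈ suc n /2⌉  ≡⟨ ⌊n/2⌋+⌈n/2⌉≡n (suc n) ⟩
  suc n                      ∎
  where open ≤-Reasoning

⌈n/2⌉≤m⇒n≤2*m : ⌈ n /2⌉ ≤ m → n ≤ 2 * m
⌈n/2⌉≤m⇒n≤2*m {n} le = ≤-trans (n≤2*⌈n/2⌉ n) (*-monoʳ-≤ 2 le)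

n≤2*m⇒⌈n/2⌉≤m : n ≤ 2 * m → ⌈ n /2⌉ ≤ m
n≤2*m⇒⌈n/2⌉≤m {n} {m} le = subst (⌈ n /2⌉ ≤_) ⌈2*m/2⌉≡m (⌈n/2⌉-mono le)
  where ⌈2*m/2⌉≡m : ⌈ 2 * m /2⌉ ≡ m
        ⌈2*m/2⌉≡m = trans (cong ⌈_/2⌉ (sym (+-identityʳ (2 * m))))
                          (trans (⌈2*m+n/2⌉≡m+⌈n/2⌉ m 0) (+-identityʳ m))

2*m<n⇒m<⌈n/2⌉ : 2 * m < n → m < ⌈ n /2⌉
2*m<n⇒m<⌈n/2⌉ lt = ≰⇒> (<⇒≱ lt ∘ ⌈n/2⌉≤m⇒n≤2*m)

m<⌈n/2⌉⇒2*m<n : m < ⌈ n /2⌉ → 2 * m < n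
m<⌈n/2⌉⇒2*m<n lt = ≰⇒> (<⇒≱ lt ∘ n≤2*m⇒⌈n/2⌉≤m)

m∸n+1≤m : 1 ≤ n → n ≤ m → m ∸ n + 1 ≤ m
m∸n+1≤m {n} {m} 1≤n n≤m = ≤-trans (≤-reflexive (+-comm (m ∸ n) 1)) (∸-monoʳ-< 1≤n n≤m)

∣m+n-o+p∣≤∣m-o∣+∣n-p∣ : ∀ m n o p → ∣ m + n - o + p ∣ ≤ ∣ m - o ∣ + ∣ n - p ∣
∣m+n-o+p∣≤∣m-o∣+∣n-p∣ m n o p = begin
  ∣ m + n - o + p ∣                    ≤⟨ ∣-∣-triangle (m + n) (o + n) (o + p) ⟩
  ∣ m + n - o + n ∣ + ∣ o + n - o + p ∣ ≡⟨ cong₂ _+_ swapped (∣m+n-m+o∣≡∣n-o∣ o n p) ⟩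
  ∣ m - o ∣ + ∣ n - p ∣                ∎
  where
  open ≤-Reasoning
  swapped : ∣ m + n - o + n ∣ ≡ ∣ m - o ∣
  swapped = trans (cong₂ ∣_-_∣ (+-comm m n) (+-comm o n)) (∣m+n-m+o∣≡∣n-o∣ n m o)

n<2^n : ∀ n → n < 2 ^ n
n<2^n zero    = s≤s z≤n
n<2^n (suc n) = begin-strict
  suc n              <⟨ s≤s (n<2^n n) ⟩
  1 + 2 ^ n          ≤⟨ +-monoˡ-≤ (2 ^ n) (m^n>0 2 n) ⟩
  2 ^ n + 2 ^ n      ≡⟨ cong (2 ^ n +_) (+-identityʳ (2 ^ n)) ⟨
  2 ^ suc n          ∎
  where open ≤-Reasoning

m+n≤2^[i+suc[j]] : ∀ i j → m ≤ 2 ^ i → n ≤ 2 ^ j → m + n ≤ 2 ^ (i + suc j)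
m+n≤2^[i+suc[j]] {m} {n} i j m≤2^i n≤2^j = begin
  m + n                         ≤⟨ +-mono-≤ (≤-trans m≤2^i (^-monoʳ-≤ 2 (m≤m+n i j)))
                                            (≤-trans n≤2^j (^-monoʳ-≤ 2 (m≤n+m j i))) ⟩
  2 ^ (i + j) + 2 ^ (i + j)     ≡⟨ cong (2 ^ (i + j) +_) (+-identityʳ _) ⟨
  2 ^ suc (i + j)               ≡⟨ cong (2 ^_) (+-suc i j) ⟨
  2 ^ (i + suc j)               ∎
  where open ≤-Reasoning

-- These follow the recursion ⌈log2⌉ (2 + m) = 1 + ⌈log2⌉ (1 + ⌈ m /2⌉) behind ⌈log₂_⌉.
n≤2^⌈log2⌉n : ∀ n (rec : Acc _<_ n) → n ≤ 2 ^ ⌈log2⌉ n rec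
n≤2^⌈log2⌉n zero          _        = z≤n
n≤2^⌈log2⌉n 1             _        = ≤-refl
n≤2^⌈log2⌉n (suc (suc m)) (acc rs) = begin
  2 + m              ≤⟨ s≤s (s≤s (n≤2*⌈n/2⌉ m)) ⟩
  2 + 2 * ⌈ m /2⌉    ≡⟨ *-suc 2 ⌈ m /2⌉ ⟨
  2 * suc ⌈ m /2⌉    ≤⟨ *-monoʳ-≤ 2 (n≤2^⌈log2⌉n (suc ⌈ m /2⌉) (rs (⌈n/2⌉<n m))) ⟩
  2 ^ ⌈log2⌉ (2 + m) (acc rs) ∎
  where open ≤-Reasoning

2^⌈log2⌉[2+n]≤2*[1+n] : ∀ n (rec : Acc _<_ (2 + n)) → 2 ^ ⌈log2⌉ (2 + n) rec ≤ 2 * suc n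
2^⌈log2⌉[2+n]≤2*[1+n] zero    (acc rs) = ≤-refl
2^⌈log2⌉[2+n]≤2*[1+n] (suc n) (acc rs) = *-monoʳ-≤ 2 (begin
  2 ^ ⌈log2⌉ (2 + ⌊ n /2⌋) (rs (⌈n/2⌉<n (suc n)))
    ≤⟨ 2^⌈log2⌉[2+n]≤2*[1+n] ⌊ n /2⌋ (rs (⌈n/2⌉<n (suc n))) ⟩
  2 * ⌈ suc n /2⌉
    ≤⟨ 2*⌈n/2⌉≤1+n (suc n) ⟩
  2 + n ∎)
  where open ≤-Reasoning

n≤2^⌈log₂n⌉ : ∀ n → n ≤ 2 ^ ⌈log₂ n ⌉
n≤2^⌈log₂n⌉ n = n≤2^⌈log2⌉n n (<-wellFounded n)

2^⌈log₂n⌉<2*n : ∀ n → 1 ≤ n → 2 ^ ⌈log₂ n ⌉ < 2 * n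
2^⌈log₂n⌉<2*n 1             _ = ≤-refl
2^⌈log₂n⌉<2*n (suc (suc n)) _ =
  ≤-<-trans (2^⌈log2⌉[2+n]≤2*[1+n] n (<-wellFounded (2 + n))) (*-monoʳ-< 2 (n<1+n (suc n)))

-- Both inequalities of Grows pass from E to suc E, and they hold at E₀ = 2 * m + 2 because m < 2 ^ m.
module _ (m : ℕ) where

  private
    E₀ = m + (2 + m)
    Grows : ℕ → Set
    Grows E = m * (m + E) ≤ 2 ^ E × m ≤ 2 ^ E

    grows-E₀ : Grows E₀
    grows-E₀ = ≤-trans (*-mono-≤ (<⇒≤ (n<2^n m)) sum≤) (≤-reflexive (sym (^-distribˡ-+-* 2 m (2 + m))))
             , ≤-trans (<⇒≤ (n<2^n m)) (^-monoʳ-≤ 2 (m≤m+n m _))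
      where
      sum≤ : m + E₀ ≤ 2 ^ (2 + m)
      sum≤ = ≤-trans (m≤m+n (m + E₀) (m + 2)) (≤-trans (≤-reflexive (regroup m)) (*-monoʳ-≤ 2 (*-monoʳ-≤ 2 (n<2^n m))))
        where regroup : ∀ m → m + (m + (2 + m)) + (m + 2) ≡ 2 * (2 * suc m)
              regroup = solve-∀

    grows-suc : ∀ {E} → Grows E → Grows (suc E)
    grows-suc {E} (bound , m≤2^E) =
        (begin
          m * (m + suc E)    ≡⟨ trans (cong (m *_) (+-suc m E)) (*-suc m (m + E)) ⟩
          m + m * (m + E)    ≤⟨ +-mono-≤ m≤2^E bound ⟩
          2 ^ E + 2 ^ E      ≡⟨ cong (2 ^ E +_) (+-identityʳ (2 ^ E)) ⟨
          2 ^ suc E          ∎)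
      , ≤-trans m≤2^E (^-monoʳ-≤ 2 (n≤1+n E))
      where open ≤-Reasoning

    grows-from-E₀ : ∀ j → Grows (E₀ + j)
    grows-from-E₀ zero    = subst Grows (sym (+-identityʳ E₀)) grows-E₀
    grows-from-E₀ (suc j) = subst Grows (sym (+-suc E₀ j)) (grows-suc (grows-from-E₀ j))

  2^n-dominates-linear : ∃[ E₀ ] ∀ E → E₀ ≤ E → m * (m + E) ≤ 2 ^ E
  2^n-dominates-linear = E₀ , λ E E₀≤E → proj₁ (subst Grows (m+[n∸m]≡n E₀≤E) (grows-from-E₀ (E ∸ E₀)))

log-sublinear : ∀ a b → ∃[ N₀ ] ∀ N → N₀ ≤ N → a * (b + ⌈log₂ N ⌉) < N
log-sublinear a b with 2^n-dominates-linear (2 * a + b)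
... | E₀ , dominates = 2 ^ E₀ , below
  where
  below : ∀ N → 2 ^ E₀ ≤ N → a * (b + ⌈log₂ N ⌉) < N
  below N 2^E₀≤N = *-cancelˡ-< 2 _ N (begin-strict
    2 * (a * (b + E))          ≤⟨ ≤-trans (≤-reflexive (sym (*-assoc 2 a (b + E)))) (*-monoˡ-≤ (b + E) (m≤m+n (2 * a) b)) ⟩
    (2 * a + b) * (b + E)      ≤⟨ *-monoʳ-≤ (2 * a + b) (+-monoˡ-≤ E (m≤n+m b (2 * a))) ⟩
    (2 * a + b) * (2 * a + b + E) ≤⟨ dominates E E₀≤E ⟩
    2 ^ E                      <⟨ 2^⌈log₂n⌉<2*n N (≤-trans (m^n>0 2 E₀) 2^E₀≤N) ⟩
    2 * N                      ∎)
    where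
    open ≤-Reasoning
    E = ⌈log₂ N ⌉
    E₀≤E : E₀ ≤ E
    E₀≤E = subst (_≤ E) (⌈log₂2^n⌉≡n E₀) (⌈log₂⌉-mono-≤ 2^E₀≤N)

𝟙[_<_] : ℕ → ℕ → ℕ
𝟙[ _     < zero  ] = 0
𝟙[ zero  < suc _ ] = 1
𝟙[ suc a < suc k ] = 𝟙[ a < k ]

𝟙[<]-yes : a < k → 𝟙[ a < k ] ≡ 1
𝟙[<]-yes {zero}  (s≤s _)   = refl
𝟙[<]-yes {suc a} (s≤s a<k) = 𝟙[<]-yes a<k

𝟙[<]-no : k ≤ a → 𝟙[ a < k ] ≡ 0
𝟙[<]-no {zero}          z≤n       = refl
𝟙[<]-no {suc k} {suc a} (s≤s k≤a) = 𝟙[<]-no k≤a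

𝟙[<]-cong : (a < k → b < l) → (b < l → a < k) → 𝟙[ a < k ] ≡ 𝟙[ b < l ]
𝟙[<]-cong {a} {k} to from with a <? k
... | yes a<k = trans (𝟙[<]-yes a<k) (sym (𝟙[<]-yes (to a<k)))
... | no  a≮k = trans (𝟙[<]-no (≮⇒≥ a≮k)) (sym (𝟙[<]-no (≮⇒≥ (a≮k ∘ from))))

𝟙[m+n<o]≡𝟙[n<o∸m] : ∀ m n o → 𝟙[ m + n < o ] ≡ 𝟙[ n < o ∸ m ]
𝟙[m+n<o]≡𝟙[n<o∸m] zero    n o       = refl
𝟙[m+n<o]≡𝟙[n<o∸m] (suc m) n zero    = refl
𝟙[m+n<o]≡𝟙[n<o∸m] (suc m) n (suc o) = 𝟙[m+n<o]≡𝟙[n<o∸m] m n o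

𝟙[2*m<n]≡𝟙[m<⌈n/2⌉] : ∀ m n → 𝟙[ 2 * m < n ] ≡ 𝟙[ m < ⌈ n /2⌉ ]
𝟙[2*m<n]≡𝟙[m<⌈n/2⌉] m n = 𝟙[<]-cong (2*m<n⇒m<⌈n/2⌉ {m} {n}) (m<⌈n/2⌉⇒2*m<n {m} {n})

∑< : ℕ → (ℕ → ℕ) → ℕ
∑< zero    f = 0
∑< (suc n) f = f 0 + ∑< n (f ∘ suc)

syntax ∑< n (λ i → e) = ∑[ i < n ] e

∑-cong : ∀ n → (∀ {i} → i < n → f i ≡ g i) → ∑< n f ≡ ∑< n g
∑-cong zero    eq = refl
∑-cong (suc n) eq = cong₂ _+_ (eq (s≤s z≤n)) (∑-cong n (eq ∘ s≤s))

∑-zero : ∀ n → ∑[ i < n ] 0 ≡ 0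
∑-zero zero    = refl
∑-zero (suc n) = ∑-zero n

∑-snoc : ∀ n f → ∑< (suc n) f ≡ ∑< n f + f n
∑-snoc zero    f = +-comm (f 0) 0
∑-snoc (suc n) f = trans (cong (f 0 +_) (∑-snoc n (f ∘ suc))) (sym (+-assoc (f 0) _ _))

∑-distrib-+ : ∀ n f g → ∑[ i < n ] (f i + g i) ≡ ∑< n f + ∑< n g
∑-distrib-+ zero    f g = refl
∑-distrib-+ (suc n) f g = trans (cong (f 0 + g 0 +_) (∑-distrib-+ n (f ∘ suc) (g ∘ suc)))
                                (+-interchange (f 0) (g 0) _ _)
  where +-interchange : ∀ w x y z → w + x + (y + z) ≡ w + y + (x + z)
        +-interchange = solve-∀

∑-comm : ∀ m n (h : ℕ → ℕ → ℕ) → ∑[ i < m ] ∑[ j < n ] h i j ≡ ∑[ j < n ] ∑[ i < m ] h i j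
∑-comm zero    n h = sym (∑-zero n)
∑-comm (suc m) n h = trans (cong (∑[ j < n ] h 0 j +_) (∑-comm m n (h ∘ suc)))
                           (sym (∑-distrib-+ n (h 0) (λ j → ∑[ i < m ] h (suc i) j)))

∑-split : ∀ m n f → ∑< (m + n) f ≡ ∑< m f + ∑[ i < n ] f (m + i)
∑-split zero    n f = refl
∑-split (suc m) n f = trans (cong (f 0 +_) (∑-split m n (f ∘ suc))) (sym (+-assoc (f 0) _ _))

∑-periodic : ∀ p → (∀ x → g (x + p) ≡ g x) → ∀ a → ∑[ i < p ] g (a + i) ≡ ∑< p g
∑-periodic         p per zero    = refl
∑-periodic {g = g} p per (suc a) = trans shift (∑-periodic p per a)
  where
  gₐ : ℕ → ℕ
  gₐ i = g (a + i)
  rotate : ∑< (suc p) gₐ ≡ gₐ 0 + ∑< p gₐ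
  rotate = begin
    ∑< (suc p) gₐ     ≡⟨ ∑-snoc p gₐ ⟩
    ∑< p gₐ + gₐ p     ≡⟨ cong (∑< p gₐ +_) (trans (per a) (cong g (sym (+-identityʳ a)))) ⟩
    ∑< p gₐ + gₐ 0     ≡⟨ +-comm (∑< p gₐ) (gₐ 0) ⟩
    gₐ 0 + ∑< p gₐ     ∎
    where open ≡-Reasoning
  shift : ∑[ i < p ] g (suc a + i) ≡ ∑[ i < p ] g (a + i)
  shift = trans (∑-cong p (λ {i} _ → cong g (sym (+-suc a i)))) (+-cancelˡ-≡ (gₐ 0) _ _ rotate)

∑-𝟙[<] : ∀ k n → ∑[ i < n ] 𝟙[ i < k ] ≡ k ⊓ n
∑-𝟙[<] zero    n       = ∑-zero n
∑-𝟙[<] (suc k) zero    = refl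
∑-𝟙[<] (suc k) (suc n) = cong suc (∑-𝟙[<] k n)

sum-map-applyUpTo : ∀ n (f g : ℕ → ℕ) → sum (map f (applyUpTo g n)) ≡ ∑[ i < n ] f (g i)
sum-map-applyUpTo zero    f g = refl
sum-map-applyUpTo (suc n) f g = cong (f (g 0) +_) (sum-map-applyUpTo n f (g ∘ suc))

-- Mountain lists

leafCount : List ℕ → ℕ
leafCount hs = sum (map (2 ^_) hs)

leafCount-reverse : ∀ hs → leafCount (reverse hs) ≡ leafCount hs
leafCount-reverse hs = trans (cong sum (reverse-map (2 ^_) hs)) (sum-↭ (↭-reverse (map (2 ^_) hs)))

leafMountainHeight-here : ∀ hs → j ≤ 2 ^ h → leafMountainHeight (h ∷ hs) j ≡ h
leafMountainHeight-here {j} {h} hs j≤2^h with j ≤ᵇ 2 ^ h | ≤⇒≤ᵇ j≤2^h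
... | true | _ = refl

leafMountainHeight-there : ∀ hs → 2 ^ h < j →
                           leafMountainHeight (h ∷ hs) j ≡ leafMountainHeight hs (j ∸ 2 ^ h)
leafMountainHeight-there {h} {j} hs 2^h<j with j ≤ᵇ 2 ^ h in eq
... | false = refl
... | true  = ⊥-elim (<⇒≱ 2^h<j (≤ᵇ⇒≤ j (2 ^ h) (subst T (sym eq) _)))

leafMountainHeight-++ˡ : ∀ xs ys → 1 ≤ j → j ≤ leafCount xs →
                         leafMountainHeight (xs ++ ys) j ≡ leafMountainHeight xs j
leafMountainHeight-++ˡ         []       ys 1≤j j≤0 = ⊥-elim (<⇒≱ 1≤j j≤0)
leafMountainHeight-++ˡ {j = j} (x ∷ xs) ys 1≤j j≤ with j ≤? 2 ^ x
... | yes j≤2^x =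
  trans (leafMountainHeight-here (xs ++ ys) j≤2^x) (sym (leafMountainHeight-here xs j≤2^x))
... | no  j≰2^x = begin
  leafMountainHeight (x ∷ xs ++ ys) j       ≡⟨ leafMountainHeight-there (xs ++ ys) 2^x<j ⟩
  leafMountainHeight (xs ++ ys) (j ∸ 2 ^ x) ≡⟨ leafMountainHeight-++ˡ xs ys (m<n⇒0<n∸m 2^x<j) j′≤ ⟩
  leafMountainHeight xs (j ∸ 2 ^ x)         ≡⟨ leafMountainHeight-there xs 2^x<j ⟨
  leafMountainHeight (x ∷ xs) j             ∎
  where
  open ≡-Reasoning
  2^x<j : 2 ^ x < j
  2^x<j = ≰⇒> j≰2^x
  j′≤ : j ∸ 2 ^ x ≤ leafCount xs
  j′≤ = subst (j ∸ 2 ^ x ≤_) (m+n∸m≡n (2 ^ x) (leafCount xs)) (∸-monoˡ-≤ (2 ^ x) j≤)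

leafMountainHeight-++ʳ : ∀ xs ys → 1 ≤ j →
                         leafMountainHeight (xs ++ ys) (leafCount xs + j) ≡ leafMountainHeight ys j
leafMountainHeight-++ʳ         []       ys 1≤j = refl
leafMountainHeight-++ʳ {j = j} (x ∷ xs) ys 1≤j = begin
  leafMountainHeight (x ∷ xs ++ ys) (2 ^ x + leafCount xs + j)
    ≡⟨ cong (leafMountainHeight (x ∷ xs ++ ys)) (+-assoc (2 ^ x) (leafCount xs) j) ⟩
  leafMountainHeight (x ∷ xs ++ ys) (2 ^ x + (leafCount xs + j))
    ≡⟨ leafMountainHeight-there (xs ++ ys) 2^x< ⟩
  leafMountainHeight (xs ++ ys) (2 ^ x + (leafCount xs + j) ∸ 2 ^ x)
    ≡⟨ cong (leafMountainHeight (xs ++ ys)) (m+n∸m≡n (2 ^ x) _) ⟩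
  leafMountainHeight (xs ++ ys) (leafCount xs + j)
    ≡⟨ leafMountainHeight-++ʳ xs ys 1≤j ⟩
  leafMountainHeight ys j ∎
  where
  open ≡-Reasoning
  2^x< : 2 ^ x < 2 ^ x + (leafCount xs + j)
  2^x< = m<m+n (2 ^ x) (≤-trans 1≤j (m≤n+m j (leafCount xs)))

leafMountainHeight-reverse : ∀ hs → 1 ≤ k → k ≤ leafCount hs →
  leafMountainHeight (reverse hs) (leafCount hs ∸ k + 1) ≡ leafMountainHeight hs k
leafMountainHeight-reverse     []       1≤k k≤0 = ⊥-elim (<⇒≱ 1≤k k≤0)
leafMountainHeight-reverse {k} (h ∷ hs) 1≤k k≤ with k ≤? 2 ^ h
... | yes k≤2^h = begin
  leafMountainHeight (reverse (h ∷ hs)) (2 ^ h + t ∸ k + 1)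
    ≡⟨ cong₂ leafMountainHeight (unfold-reverse h hs) position ⟩
  leafMountainHeight (reverse hs ++ [ h ]) (leafCount (reverse hs) + (2 ^ h ∸ k + 1))
    ≡⟨ leafMountainHeight-++ʳ (reverse hs) [ h ] (m≤n+m 1 (2 ^ h ∸ k)) ⟩
  leafMountainHeight [ h ] (2 ^ h ∸ k + 1)
    ≡⟨ leafMountainHeight-here [] (m∸n+1≤m 1≤k k≤2^h) ⟩
  h
    ≡⟨ leafMountainHeight-here hs k≤2^h ⟨
  leafMountainHeight (h ∷ hs) k ∎
  where
  open ≡-Reasoning
  t = leafCount hs
  position : 2 ^ h + t ∸ k + 1 ≡ leafCount (reverse hs) + (2 ^ h ∸ k + 1)
  position = begin
    2 ^ h + t ∸ k + 1          ≡⟨ cong (λ x → x ∸ k + 1) (+-comm (2 ^ h) t) ⟩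
    t + 2 ^ h ∸ k + 1          ≡⟨ cong (_+ 1) (+-∸-assoc t k≤2^h) ⟩
    t + (2 ^ h ∸ k) + 1        ≡⟨ +-assoc t (2 ^ h ∸ k) 1 ⟩
    t + (2 ^ h ∸ k + 1)        ≡⟨ cong (_+ (2 ^ h ∸ k + 1)) (leafCount-reverse hs) ⟨
    leafCount (reverse hs) + (2 ^ h ∸ k + 1) ∎
... | no k≰2^h = begin
  leafMountainHeight (reverse (h ∷ hs)) (2 ^ h + t ∸ k + 1)
    ≡⟨ cong₂ leafMountainHeight (unfold-reverse h hs) (cong (_+ 1) position) ⟩
  leafMountainHeight (reverse hs ++ [ h ]) (t ∸ k′ + 1)
    ≡⟨ leafMountainHeight-++ˡ (reverse hs) [ h ] (m≤n+m 1 (t ∸ k′)) inside ⟩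
  leafMountainHeight (reverse hs) (t ∸ k′ + 1)
    ≡⟨ leafMountainHeight-reverse hs (m<n⇒0<n∸m 2^h<k) k′≤t ⟩
  leafMountainHeight hs k′
    ≡⟨ leafMountainHeight-there hs 2^h<k ⟨
  leafMountainHeight (h ∷ hs) k ∎
  where
  open ≡-Reasoning
  t = leafCount hs
  2^h<k : 2 ^ h < k
  2^h<k = ≰⇒> k≰2^h
  k′ = k ∸ 2 ^ h
  k′≤t : k′ ≤ t
  k′≤t = m≤n+o⇒m∸n≤o k (2 ^ h) k≤
  position : 2 ^ h + t ∸ k ≡ t ∸ k′
  position = trans (cong (2 ^ h + t ∸_) (sym (m+[n∸m]≡n (<⇒≤ 2^h<k)))) ([m+n]∸[m+o]≡n∸o (2 ^ h) t k′)
  inside : t ∸ k′ + 1 ≤ leafCount (reverse hs)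
  inside = subst (t ∸ k′ + 1 ≤_) (sym (leafCount-reverse hs)) (m∸n+1≤m (m<n⇒0<n∸m 2^h<k) k′≤t)

push-map-suc : ∀ h hs → push (suc h) (map suc hs) ≡ map suc (push h hs)
push-map-suc h []        = refl
push-map-suc h (h′ ∷ hs) with h ≟ h′ | suc h ≟ suc h′
... | yes _    | yes _      = push-map-suc (suc h) hs
... | yes h≡h′ | no  sh≢sh′ = ⊥-elim (sh≢sh′ (cong suc h≡h′))
... | no  h≢h′ | yes sh≡sh′ = ⊥-elim (h≢h′ (suc-injective sh≡sh′))
... | no  _    | no  _      = refl

leafCount-push : ∀ h hs → leafCount (push h hs) ≡ 2 ^ h + leafCount hs
leafCount-push h []        = refl
leafCount-push h (h′ ∷ hs) with h ≟ h′
... | no  _    = refl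
... | yes refl = trans (leafCount-push (suc h) hs)
                       (trans (cong (λ x → 2 ^ h + x + leafCount hs) (+-identityʳ (2 ^ h)))
                              (+-assoc (2 ^ h) (2 ^ h) (leafCount hs)))

leafCount-peaksRL : ∀ n → leafCount (peaksRL n) ≡ n
leafCount-peaksRL zero    = refl
leafCount-peaksRL (suc n) = trans (leafCount-push 0 (peaksRL n)) (cong suc (leafCount-peaksRL n))

leafCount-map-suc : ∀ hs → leafCount (map suc hs) ≡ 2 * leafCount hs
leafCount-map-suc []       = refl
leafCount-map-suc (h ∷ hs) =
  trans (cong (2 ^ suc h +_) (leafCount-map-suc hs)) (sym (*-distribˡ-+ 2 (2 ^ h) (leafCount hs)))

peaksRL-even : ∀ m → peaksRL (2 * m) ≡ map suc (peaksRL m)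
peaksRL-odd  : ∀ m → peaksRL (suc (2 * m)) ≡ 0 ∷ map suc (peaksRL m)

peaksRL-even zero    = refl
peaksRL-even (suc m) = begin
  peaksRL (2 * suc m)                   ≡⟨ cong peaksRL (*-suc 2 m) ⟩
  push 0 (peaksRL (suc (2 * m)))        ≡⟨ cong (push 0) (peaksRL-odd m) ⟩
  push 1 (map suc (peaksRL m))          ≡⟨ push-map-suc 0 (peaksRL m) ⟩
  map suc (peaksRL (suc m))             ∎
  where open ≡-Reasoning

peaksRL-odd m = trans (cong (push 0) (peaksRL-even m)) (push-0-map-suc (peaksRL m))
  where push-0-map-suc : ∀ hs → push 0 (map suc hs) ≡ 0 ∷ map suc hs
        push-0-map-suc []      = refl
        push-0-map-suc (_ ∷ _) = refl

leafCount-map-suc-peaksRL : ∀ m → leafCount (map suc (peaksRL m)) ≡ 2 * m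
leafCount-map-suc-peaksRL m = trans (leafCount-map-suc (peaksRL m)) (cong (2 *_) (leafCount-peaksRL m))

leafMountainHeight-map-suc : ∀ hs → 1 ≤ k → k ≤ leafCount (map suc hs) →
  leafMountainHeight (map suc hs) k ≡ suc (leafMountainHeight hs ⌈ k /2⌉)
leafMountainHeight-map-suc     []       1≤k k≤0 = ⊥-elim (<⇒≱ 1≤k k≤0)
leafMountainHeight-map-suc {k} (h ∷ hs) 1≤k k≤ with k ≤? 2 ^ suc h
... | yes k≤2^sh = trans (leafMountainHeight-here (map suc hs) k≤2^sh)
                         (cong suc (sym (leafMountainHeight-here hs (n≤2*m⇒⌈n/2⌉≤m k≤2^sh))))
... | no  k≰2^sh = begin
  leafMountainHeight (map suc (h ∷ hs)) k        ≡⟨ leafMountainHeight-there (map suc hs) 2^sh<k ⟩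
  leafMountainHeight (map suc hs) (k ∸ 2 ^ suc h) ≡⟨ leafMountainHeight-map-suc hs (m<n⇒0<n∸m 2^sh<k)
                                                        (m≤n+o⇒m∸n≤o k (2 ^ suc h) k≤) ⟩
  suc (leafMountainHeight hs ⌈ k ∸ 2 ^ suc h /2⌉) ≡⟨ cong (suc ∘ leafMountainHeight hs) halve ⟩
  suc (leafMountainHeight hs (⌈ k /2⌉ ∸ 2 ^ h))   ≡⟨ cong suc (leafMountainHeight-there hs (2*m<n⇒m<⌈n/2⌉ 2^sh<k)) ⟨
  suc (leafMountainHeight (h ∷ hs) ⌈ k /2⌉)       ∎
  where
  open ≡-Reasoning
  2^sh<k : 2 ^ suc h < k
  2^sh<k = ≰⇒> k≰2^sh
  halve : ⌈ k ∸ 2 ^ suc h /2⌉ ≡ ⌈ k /2⌉ ∸ 2 ^ h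
  halve = begin
    ⌈ k ∸ 2 ^ suc h /2⌉                          ≡⟨ m+n∸m≡n (2 ^ h) _ ⟨
    2 ^ h + ⌈ k ∸ 2 ^ suc h /2⌉ ∸ 2 ^ h          ≡⟨ cong (_∸ 2 ^ h) (⌈2*m+n/2⌉≡m+⌈n/2⌉ (2 ^ h) _) ⟨
    ⌈ 2 ^ suc h + (k ∸ 2 ^ suc h) /2⌉ ∸ 2 ^ h    ≡⟨ cong (λ x → ⌈ x /2⌉ ∸ 2 ^ h) (m+[n∸m]≡n (<⇒≤ 2^sh<k)) ⟩
    ⌈ k /2⌉ ∸ 2 ^ h                              ∎

-- The height of a leaf as a count of levels

[b+2*q]%[2*m]≡b+2*[q%m] : ∀ b q m .{{_ : NonZero m}} .{{_ : NonZero (2 * m)}} → b < 2 →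
                          (b + 2 * q) % (2 * m) ≡ b + 2 * (q % m)
[b+2*q]%[2*m]≡b+2*[q%m] b q m@(suc _) b<2 = begin
  (b + 2 * q) % (2 * m)  ≡⟨ %-congˡ {o = 2 * m} (trans (+-comm b (2 * q)) (cong (_+ b) (*-comm 2 q))) ⟩
  (q * 2 + b) % (2 * m)  ≡⟨ %-congʳ {o = q * 2 + b} (*-comm 2 m) ⟩
  (q * 2 + b) % (m * 2)  ≡⟨ [m*n+o]%[p*n]≡[m*n]%[p*n]+o q m b<2 ⟩
  (q * 2) % (m * 2) + b  ≡⟨ cong (_+ b) (m%n*o≡m*o%[n*o] q m 2) ⟨
  q % m * 2 + b          ≡⟨ trans (+-comm _ b) (cong (b +_) (*-comm (q % m) 2)) ⟩
  b + 2 * (q % m)        ∎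
  where open ≡-Reasoning

_mod2^_ : ℕ → ℕ → ℕ
n mod2^ j = _%_ n (2 ^ j) {{m^n≢0 2 j}}

levelCount : ℕ → ℕ → ℕ → ℕ
levelCount B k n = ∑[ i < B ] 𝟙[ n mod2^ suc i < k ]

levelCount-halve : ∀ B k q b → b < 2 →
  levelCount (suc B) k (b + 2 * q) ≡ 𝟙[ b < k ] + levelCount B ⌈ k ∸ b /2⌉ q
levelCount-halve B k q b b<2 = cong₂ _+_ lowest (∑-cong B (λ {i} _ → higher i))
  where
  open ≡-Reasoning
  lowest : 𝟙[ (b + 2 * q) mod2^ 1 < k ] ≡ 𝟙[ b < k ]
  lowest = cong 𝟙[_< k ] (begin
    (b + 2 * q) % 2       ≡⟨ [b+2*q]%[2*m]≡b+2*[q%m] b q 1 b<2 ⟩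
    b + 2 * (q % 1)       ≡⟨ cong (λ r → b + 2 * r) (n%1≡0 q) ⟩
    b + 0                 ≡⟨ +-identityʳ b ⟩
    b                     ∎)
  higher : ∀ i → 𝟙[ (b + 2 * q) mod2^ suc (suc i) < k ] ≡ 𝟙[ q mod2^ suc i < ⌈ k ∸ b /2⌉ ]
  higher i = begin
    𝟙[ (b + 2 * q) mod2^ suc (suc i) < k ]
      ≡⟨ cong 𝟙[_< k ] ([b+2*q]%[2*m]≡b+2*[q%m] b q (2 ^ suc i) {{m^n≢0 2 (suc i)}} {{m^n≢0 2 (suc (suc i))}} b<2) ⟩
    𝟙[ b + 2 * (q mod2^ suc i) < k ]    ≡⟨ 𝟙[m+n<o]≡𝟙[n<o∸m] b _ k ⟩
    𝟙[ 2 * (q mod2^ suc i) < k ∸ b ]    ≡⟨ 𝟙[2*m<n]≡𝟙[m<⌈n/2⌉] _ (k ∸ b) ⟩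
    𝟙[ q mod2^ suc i < ⌈ k ∸ b /2⌉ ]    ∎

data Parity : ℕ → Set where
  even : ∀ m → Parity (2 * m)
  odd  : ∀ m → Parity (suc (2 * m))

parity : ∀ n → Parity n
parity zero    = even 0
parity (suc n) with parity n
... | even m = odd m
... | odd  m = subst Parity (*-suc 2 m) (even (suc m))

leafMountainHeight-peaksRL : ∀ B n → 1 ≤ k → k ≤ n → n < 2 ^ B →
  leafMountainHeight (peaksRL n) k ≡ levelCount B k n
leafMountainHeight-peaksRL zero n 1≤k k≤n (s≤s n≤0) = ⊥-elim (<⇒≱ (≤-trans 1≤k k≤n) n≤0)
leafMountainHeight-peaksRL (suc B) n 1≤k k≤n n<2^sB with parity n
leafMountainHeight-peaksRL {k} (suc B) _ 1≤k k≤2m 2m<2^sB | even m = begin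
  leafMountainHeight (peaksRL (2 * m)) k         ≡⟨ cong (λ hs → leafMountainHeight hs k) (peaksRL-even m) ⟩
  leafMountainHeight (map suc (peaksRL m)) k     ≡⟨ leafMountainHeight-map-suc (peaksRL m) 1≤k k≤ ⟩
  suc (leafMountainHeight (peaksRL m) ⌈ k /2⌉)   ≡⟨ cong suc (leafMountainHeight-peaksRL B m
                                                       (2*m<n⇒m<⌈n/2⌉ 1≤k) (n≤2*m⇒⌈n/2⌉≤m k≤2m) m<2^B) ⟩
  suc (levelCount B ⌈ k /2⌉ m)                   ≡⟨ cong (_+ levelCount B ⌈ k /2⌉ m) (𝟙[<]-yes 1≤k) ⟨
  𝟙[ 0 < k ] + levelCount B ⌈ k /2⌉ m            ≡⟨ levelCount-halve B k m 0 (s≤s z≤n) ⟨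
  levelCount (suc B) k (2 * m)                   ∎
  where
  open ≡-Reasoning
  k≤ : k ≤ leafCount (map suc (peaksRL m))
  k≤ = subst (k ≤_) (sym (leafCount-map-suc-peaksRL m)) k≤2m
  m<2^B : m < 2 ^ B
  m<2^B = *-cancelˡ-< 2 m (2 ^ B) 2m<2^sB
leafMountainHeight-peaksRL {1} (suc B) _ _ _ _ | odd m = begin
  leafMountainHeight (peaksRL (suc (2 * m))) 1   ≡⟨ cong (λ hs → leafMountainHeight hs 1) (peaksRL-odd m) ⟩
  0                                              ≡⟨ ∑-zero B ⟨
  𝟙[ 1 < 1 ] + levelCount B ⌈ 0 /2⌉ m            ≡⟨ levelCount-halve B 1 m 1 (s≤s (s≤s z≤n)) ⟨
  levelCount (suc B) 1 (suc (2 * m))             ∎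
  where open ≡-Reasoning
leafMountainHeight-peaksRL {suc (suc k)} (suc B) _ _ (s≤s k<2m) 2m+1<2^sB | odd m = begin
  leafMountainHeight (peaksRL (suc (2 * m))) (2 + k)   ≡⟨ cong (λ hs → leafMountainHeight hs (2 + k)) (peaksRL-odd m) ⟩
  leafMountainHeight (map suc (peaksRL m)) (suc k)     ≡⟨ leafMountainHeight-map-suc (peaksRL m) (s≤s z≤n) k< ⟩
  suc (leafMountainHeight (peaksRL m) ⌈ suc k /2⌉)     ≡⟨ cong suc (leafMountainHeight-peaksRL B m
                                                             (s≤s z≤n) (n≤2*m⇒⌈n/2⌉≤m k<2m) m<2^B) ⟩
  suc (levelCount B ⌈ suc k /2⌉ m)                     ≡⟨ levelCount-halve B (2 + k) m 1 (s≤s (s≤s z≤n)) ⟨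
  levelCount (suc B) (2 + k) (suc (2 * m))             ∎
  where
  open ≡-Reasoning
  k< : suc k ≤ leafCount (map suc (peaksRL m))
  k< = subst (suc k ≤_) (sym (leafCount-map-suc-peaksRL m)) k<2m
  m<2^B : m < 2 ^ B
  m<2^B = *-cancelˡ-< 2 m (2 ^ B) (≤-trans (n≤1+n _) 2m+1<2^sB)

σ≡levelCount : ∀ B → 1 ≤ k → k ≤ n → n < 2 ^ B → σ k n ≡ levelCount B k n
σ≡levelCount {k} {n} B 1≤k k≤n n<2^B = begin
  σ k n
    ≡⟨ cong (λ x → leafMountainHeight (mountains n) (x ∸ k + 1)) (leafCount-peaksRL n) ⟨
  leafMountainHeight (reverse (peaksRL n)) (leafCount (peaksRL n) ∸ k + 1)
    ≡⟨ leafMountainHeight-reverse (peaksRL n) 1≤k (subst (k ≤_) (sym (leafCount-peaksRL n)) k≤n) ⟩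
  leafMountainHeight (peaksRL n) k
    ≡⟨ leafMountainHeight-peaksRL B n 1≤k k≤n n<2^B ⟩
  levelCount B k n ∎
  where open ≡-Reasoning

-- Counting the levels over consecutive sizes

hits : ∀ M .{{_ : NonZero M}} → ℕ → ℕ → ℕ → ℕ
hits M k a N = ∑[ t < N ] 𝟙[ (a + t) % M < k ]

module _ (M : ℕ) .{{_ : NonZero M}} (k : ℕ) where

  hits-period : ∀ a → hits M k a M ≡ k ⊓ M
  hits-period a = begin
    ∑[ t < M ] 𝟙[ (a + t) % M < k ]  ≡⟨ ∑-periodic M (λ x → cong 𝟙[_< k ] ([m+n]%n≡m%n x M)) a ⟩
    ∑[ t < M ] 𝟙[ t % M < k ]        ≡⟨ ∑-cong M (λ t<M → cong 𝟙[_< k ] (m<n⇒m%n≡m t<M)) ⟩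
    ∑[ t < M ] 𝟙[ t < k ]            ≡⟨ ∑-𝟙[<] k M ⟩
    k ⊓ M                            ∎
    where open ≡-Reasoning

  hits-periods : ∀ q a r → hits M k a (q * M + r) ≡ q * (k ⊓ M) + hits M k (a + q * M) r
  hits-periods zero    a r = cong (λ x → hits M k x r) (sym (+-identityʳ a))
  hits-periods (suc q) a r = begin
    hits M k a (M + q * M + r)                          ≡⟨ cong (hits M k a) (+-assoc M (q * M) r) ⟩
    hits M k a (M + (q * M + r))                        ≡⟨ ∑-split M (q * M + r) _ ⟩
    hits M k a M + ∑[ t < q * M + r ] 𝟙[ (a + (M + t)) % M < k ]
      ≡⟨ cong₂ _+_ (hits-period a) (∑-cong (q * M + r) (λ {t} _ → cong (λ x → 𝟙[ x % M < k ]) (sym (+-assoc a M t)))) ⟩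
    k ⊓ M + hits M k (a + M) (q * M + r)                ≡⟨ cong (k ⊓ M +_) (hits-periods q (a + M) r) ⟩
    k ⊓ M + (q * (k ⊓ M) + hits M k (a + M + q * M) r)  ≡⟨ +-assoc (k ⊓ M) _ _ ⟨
    suc q * (k ⊓ M) + hits M k (a + M + q * M) r        ≡⟨ cong (λ x → suc q * (k ⊓ M) + hits M k x r) (+-assoc a M (q * M)) ⟩
    suc q * (k ⊓ M) + hits M k (a + suc q * M) r        ∎
    where open ≡-Reasoning

  hits≤ : ∀ a r → r ≤ M → hits M k a r ≤ k ⊓ M
  hits≤ a r r≤M = begin
    hits M k a r                                         ≤⟨ m≤m+n _ _ ⟩
    hits M k a r + ∑[ t < M ∸ r ] 𝟙[ (a + (r + t)) % M < k ] ≡⟨ ∑-split r (M ∸ r) _ ⟨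
    hits M k a (r + (M ∸ r))                             ≡⟨ cong (hits M k a) (m+[n∸m]≡n r≤M) ⟩
    hits M k a M                                         ≡⟨ hits-period a ⟩
    k ⊓ M                                                ∎
    where open ≤-Reasoning

  hits-bound : ∀ a N → ∣ M * hits M k a N - N * (k ⊓ M) ∣ ≤ M * k
  hits-bound a N = begin
    ∣ M * hits M k a N - N * P ∣             ≡⟨ cong₂ ∣_-_∣ scaledHits scaledN ⟩
    ∣ q * M * P + M * C - q * M * P + r * P ∣ ≡⟨ ∣m+n-m+o∣≡∣n-o∣ (q * M * P) (M * C) (r * P) ⟩
    ∣ M * C - r * P ∣                        ≤⟨ ∣m-n∣≤m⊔n (M * C) (r * P) ⟩
    M * C ⊔ r * P                            ≤⟨ ⊔-lub (*-monoʳ-≤ M (≤-trans (hits≤ _ r (<⇒≤ r<M)) (m⊓n≤m k M)))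
                                                     (*-mono-≤ (<⇒≤ r<M) (m⊓n≤m k M)) ⟩
    M * k                                    ∎
    where
    open ≤-Reasoning
    P = k ⊓ M
    q = N / M
    r = N % M
    r<M : r < M
    r<M = m%n<n N M
    C = hits M k (a + q * M) r
    N≡qM+r : N ≡ q * M + r
    N≡qM+r = trans (m≡m%n+[m/n]*n N M) (+-comm r (q * M))
    reassoc : ∀ M q P → M * (q * P) ≡ q * M * P
    reassoc = solve-∀
    scaledHits : M * hits M k a N ≡ q * M * P + M * C
    scaledHits = begin-equality
      M * hits M k a N             ≡⟨ cong (λ x → M * hits M k a x) N≡qM+r ⟩
      M * hits M k a (q * M + r)   ≡⟨ cong (M *_) (hits-periods q a r) ⟩
      M * (q * P + C)              ≡⟨ *-distribˡ-+ M (q * P) C ⟩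
      M * (q * P) + M * C          ≡⟨ cong (_+ M * C) (reassoc M q P) ⟩
      q * M * P + M * C            ∎
    scaledN : N * P ≡ q * M * P + r * P
    scaledN = trans (cong (_* P) N≡qM+r) (*-distribʳ-+ P (q * M) r)

levelHits : ℕ → ℕ → ℕ → ℕ → ℕ
levelHits B k a N = ∑[ i < B ] hits (2 ^ suc i) {{m^n≢0 2 (suc i)}} k a N

partialSum≡levelHits : ∀ {N} B → 1 ≤ k → k + N ≤ 2 ^ B → partialSum k N ≡ levelHits B k k N
partialSum≡levelHits {k} {N} B 1≤k k+N≤2^B = begin
  partialSum k N                     ≡⟨ sum-map-applyUpTo N (λ t → σ k (k + t)) id ⟩
  ∑[ t < N ] σ k (k + t)             ≡⟨ ∑-cong N (λ t<N → σ≡levelCount B 1≤k (m≤m+n k _)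
                                          (<-≤-trans (+-monoʳ-< k t<N) k+N≤2^B)) ⟩
  ∑[ t < N ] levelCount B k (k + t)  ≡⟨ ∑-comm N B _ ⟩
  levelHits B k k N                  ∎
  where open ≡-Reasoning

-- 2 ^ B times the mean of levelCount B k over a period of length 2 ^ B,
-- that is ∑[ i < B ] 2 ^ (B ∸ suc i) * (k ⊓ 2 ^ suc i)
scaledMeanLevelCount : ℕ → ℕ → ℕ
scaledMeanLevelCount k zero    = 0
scaledMeanLevelCount k (suc B) = 2 * scaledMeanLevelCount k B + k ⊓ 2 ^ suc B

levelHits-bound : ∀ B k a N →
  ∣ 2 ^ B * levelHits B k a N - N * scaledMeanLevelCount k B ∣ ≤ B * k * 2 ^ B
levelHits-bound zero    k a N = ≤-reflexive (cong ∣ 0 -_∣ (*-zeroʳ N))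
levelHits-bound (suc B) k a N = begin
  ∣ 2 ^ suc B * levelHits (suc B) k a N - N * (2 * W + P) ∣
    ≡⟨ cong₂ ∣_-_∣ (trans (cong (2 ^ suc B *_) (∑-snoc B _)) (split₁ X H C)) (split₂ N W P) ⟩
  ∣ 2 * (X * H) + 2 * X * C - 2 * (N * W) + N * P ∣
    ≤⟨ ∣m+n-o+p∣≤∣m-o∣+∣n-p∣ (2 * (X * H)) (2 * X * C) (2 * (N * W)) (N * P) ⟩
  ∣ 2 * (X * H) - 2 * (N * W) ∣ + ∣ 2 * X * C - N * P ∣
    ≡⟨ cong (_+ ∣ 2 * X * C - N * P ∣) (*-distribˡ-∣-∣ 2 (X * H) (N * W)) ⟨
  2 * ∣ X * H - N * W ∣ + ∣ 2 * X * C - N * P ∣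
    ≤⟨ +-mono-≤ (*-monoʳ-≤ 2 (levelHits-bound B k a N)) (hits-bound (2 ^ suc B) {{m^n≢0 2 (suc B)}} k a N) ⟩
  2 * (B * k * X) + 2 * X * k
    ≡⟨ collect B k X ⟩
  suc B * k * 2 ^ suc B ∎
  where
  open ≤-Reasoning
  X = 2 ^ B
  H = levelHits B k a N
  C = hits (2 ^ suc B) {{m^n≢0 2 (suc B)}} k a N
  W = scaledMeanLevelCount k B
  P = k ⊓ 2 ^ suc B
  split₁ : ∀ X H C → 2 * X * (H + C) ≡ 2 * (X * H) + 2 * X * C
  split₁ = solve-∀
  split₂ : ∀ N W P → N * (2 * W + P) ≡ 2 * (N * W) + N * P
  split₂ = solve-∀
  collect : ∀ B k X → 2 * (B * k * X) + 2 * X * k ≡ suc B * k * (2 * X)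
  collect = solve-∀

scaledMeanLevelCount-small : ∀ B → 2 ^ B ≤ k → scaledMeanLevelCount k B ≡ B * 2 ^ B
scaledMeanLevelCount-small     zero    _      = refl
scaledMeanLevelCount-small {k} (suc B) 2^sB≤k = begin
  2 * scaledMeanLevelCount k B + k ⊓ 2 ^ suc B  ≡⟨ cong₂ _+_ (cong (2 *_) (scaledMeanLevelCount-small B 2^B≤k))
                                                            (m≥n⇒m⊓n≡n 2^sB≤k) ⟩
  2 * (B * 2 ^ B) + 2 * 2 ^ B                   ≡⟨ collect B (2 ^ B) ⟩
  suc B * 2 ^ suc B                             ∎
  where
  open ≡-Reasoning
  2^B≤k : 2 ^ B ≤ k
  2^B≤k = ≤-trans (^-monoʳ-≤ 2 (n≤1+n B)) 2^sB≤k
  collect : ∀ B X → 2 * (B * X) + 2 * X ≡ suc B * (2 * X)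
  collect = solve-∀

-- With c = 2 ^ D this says scaledMeanLevelCount k B / 2 ^ B = D + 2 * k / c - 1 - k / 2 ^ B.
scaledMeanLevelCount-closedForm : ∀ D → k ≤ 2 ^ D → 2 ^ D < 2 * k → ∀ j →
  2 ^ D * (scaledMeanLevelCount k (D + j) + k + 2 ^ (D + j)) ≡ 2 ^ (D + j) * (2 ^ D * D + 2 * k)
scaledMeanLevelCount-closedForm {k} D k≤c c<2k zero rewrite +-identityʳ D =
  cong (2 ^ D *_) (base D k k≤c c<2k)
  where
  base : ∀ D k → k ≤ 2 ^ D → 2 ^ D < 2 * k → scaledMeanLevelCount k D + k + 2 ^ D ≡ 2 ^ D * D + 2 * k
  base zero    zero          _          ()
  base zero    1             _          _       = refl
  base zero    (suc (suc k)) (s≤s ())   _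
  base (suc D) k             k≤2^sD     2^sD<2k = begin
    2 * scaledMeanLevelCount k D + k ⊓ 2 ^ suc D + k + 2 ^ suc D
      ≡⟨ cong₂ (λ x y → 2 * x + y + k + 2 ^ suc D)
               (scaledMeanLevelCount-small D (<⇒≤ (*-cancelˡ-< 2 (2 ^ D) k 2^sD<2k))) (m≤n⇒m⊓n≡m k≤2^sD) ⟩
    2 * (D * 2 ^ D) + k + k + 2 * 2 ^ D
      ≡⟨ collect D (2 ^ D) k ⟩
    2 ^ suc D * suc D + 2 * k ∎
    where
    open ≡-Reasoning
    collect : ∀ D X k → 2 * (D * X) + k + k + 2 * X ≡ 2 * X * suc D + 2 * k
    collect = solve-∀
scaledMeanLevelCount-closedForm {k} D k≤c c<2k (suc j) rewrite +-suc D j = begin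
  c * (2 * W + k ⊓ 2 ^ suc (D + j) + k + 2 ^ suc (D + j))
    ≡⟨ cong (λ x → c * (2 * W + x + k + 2 ^ suc (D + j))) (m≤n⇒m⊓n≡m k≤2^sB) ⟩
  c * (2 * W + k + k + 2 * 2 ^ (D + j))
    ≡⟨ double c W k (2 ^ (D + j)) ⟩
  2 * (c * (W + k + 2 ^ (D + j)))
    ≡⟨ cong (2 *_) (scaledMeanLevelCount-closedForm D k≤c c<2k j) ⟩
  2 * (2 ^ (D + j) * (c * D + 2 * k))
    ≡⟨ *-assoc 2 (2 ^ (D + j)) _ ⟨
  2 ^ suc (D + j) * (c * D + 2 * k) ∎
  where
  open ≡-Reasoning
  c = 2 ^ D
  W = scaledMeanLevelCount k (D + j)
  k≤2^sB : k ≤ 2 ^ suc (D + j)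
  k≤2^sB = ≤-trans k≤c (^-monoʳ-≤ 2 (≤-trans (m≤m+n D j) (n≤1+n _)))
  double : ∀ c W k X → c * (2 * W + k + k + 2 * X) ≡ 2 * (c * (W + k + X))
  double = solve-∀

-- With c = 2 ^ D and B = D + j, this is ∣ partialSum k N / N - (D + 2 * k / c - 1) ∣ ≤ (B + 1) * k / N.
partialSum-bound : ∀ {N} D j → k ≤ 2 ^ D → 2 ^ D < 2 * k → k + N ≤ 2 ^ (D + j) →
  ∣ 2 ^ D * (partialSum k N + N) - N * (2 ^ D * D + 2 * k) ∣ ≤ 2 ^ D * (suc (D + j) * k)
partialSum-bound {k} {N} D j k≤c c<2k k+N≤X = *-cancelˡ-≤ X (begin
  X * ∣ c * (S + N) - N * Q ∣
    ≡⟨ *-distribˡ-∣-∣ X (c * (S + N)) (N * Q) ⟩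
  ∣ X * (c * (S + N)) - X * (N * Q) ∣
    ≡⟨ cong₂ ∣_-_∣ scaledSum scaledMean ⟩
  ∣ c * (X * H) + c * N * X - c * (N * W) + (c * N * X + N * c * k) ∣
    ≤⟨ ∣m+n-o+p∣≤∣m-o∣+∣n-p∣ (c * (X * H)) (c * N * X) (c * (N * W)) (c * N * X + N * c * k) ⟩
  ∣ c * (X * H) - c * (N * W) ∣ + ∣ c * N * X - c * N * X + N * c * k ∣
    ≡⟨ cong₂ _+_ (*-distribˡ-∣-∣ c (X * H) (N * W)) (sym (∣m-m+n∣≡n (c * N * X) (N * c * k))) ⟨
  c * ∣ X * H - N * W ∣ + N * c * k
    ≤⟨ +-mono-≤ (*-monoʳ-≤ c (levelHits-bound B k k N)) N≤X′ ⟩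
  c * (B * k * X) + X * (c * k)
    ≡⟨ collect X c B k ⟩
  X * (c * (suc B * k)) ∎)
  where
  open ≤-Reasoning
  B = D + j
  X = 2 ^ B
  c = 2 ^ D
  Q = c * D + 2 * k
  S = partialSum k N
  H = levelHits B k k N
  W = scaledMeanLevelCount k B
  instance _ = m^n≢0 2 B
  1≤k : 1 ≤ k
  1≤k = *-cancelˡ-< 2 0 k (≤-<-trans z≤n c<2k)
  N≤X′ : N * c * k ≤ X * (c * k)
  N≤X′ = ≤-trans (≤-reflexive (*-assoc N c k)) (*-monoˡ-≤ (c * k) (≤-trans (m≤n+m N k) k+N≤X))
  scaledSum : X * (c * (S + N)) ≡ c * (X * H) + c * N * X
  scaledSum = begin-equality
    X * (c * (S + N))       ≡⟨ cong (λ s → X * (c * (s + N))) (partialSum≡levelHits B 1≤k k+N≤X) ⟩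
    X * (c * (H + N))       ≡⟨ spread X c H N ⟩
    c * (X * H) + c * N * X ∎
    where spread : ∀ X c H N → X * (c * (H + N)) ≡ c * (X * H) + c * N * X
          spread = solve-∀
  scaledMean : X * (N * Q) ≡ c * (N * W) + (c * N * X + N * c * k)
  scaledMean = begin-equality
    X * (N * Q)                           ≡⟨ *-comm-middle X N Q ⟩
    N * (X * Q)                           ≡⟨ cong (N *_) (scaledMeanLevelCount-closedForm D k≤c c<2k j) ⟨
    N * (c * (W + k + X))                 ≡⟨ spread N c W k X ⟩
    c * (N * W) + (c * N * X + N * c * k) ∎
    where *-comm-middle : ∀ X N Q → X * (N * Q) ≡ N * (X * Q)
          *-comm-middle = solve-∀
          spread : ∀ N c W k X → N * (c * (W + k + X)) ≡ c * (N * W) + (c * N * X + N * c * k)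
          spread = solve-∀
  collect : ∀ X c B k → c * (B * k * X) + X * (c * k) ≡ X * (c * (suc B * k))
  collect = solve-∀

-- Passing to ℚ

∣m⊖n∣≡∣m-n∣ : ∀ m n → ℤ.∣ m ⊖ n ∣ ≡ ∣ m - n ∣
∣m⊖n∣≡∣m-n∣ zero    zero    = refl
∣m⊖n∣≡∣m-n∣ zero    (suc n) = refl
∣m⊖n∣≡∣m-n∣ (suc m) zero    = refl
∣m⊖n∣≡∣m-n∣ (suc m) (suc n) = trans (cong ℤ.∣_∣ (ℤ.[1+m]⊖[1+n]≡m⊖n m n)) (∣m⊖n∣≡∣m-n∣ m n)

toℚᵘ-homo-minus : ∀ p q → toℚᵘ (p ℚ.- q) ℚᵘ.≃ toℚᵘ p ℚᵘ.- toℚᵘ q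
toℚᵘ-homo-minus p q = ℚᵘ.≃-trans (ℚ.toℚᵘ-homo-+ p (ℚ.- q)) (ℚᵘ.+-congʳ (toℚᵘ p) (ℚ.toℚᵘ-homo‿- q))

-- The left-hand side is literally the cross-multiplied numerator of the ℚᵘ difference in
-- s/N - ((d + t/C) - 1), so that this identity type-checks against `*≡*` by unfolding.
fraction-identity : ∀ s d t C N →
  (s ℤ.* ((ℤ.+ 1 ℤ.* C) ℤ.* ℤ.+ 1) ℤ.+ ℤ.- ((d ℤ.* C ℤ.+ t ℤ.* ℤ.+ 1) ℤ.* ℤ.+ 1 ℤ.+ ℤ.- ℤ.+ 1 ℤ.* (ℤ.+ 1 ℤ.* C)) ℤ.* N) ℤ.* (C ℤ.* N)
  ≡ (C ℤ.* (s ℤ.+ N) ℤ.- N ℤ.* (C ℤ.* d ℤ.+ t)) ℤ.* (N ℤ.* ((ℤ.+ 1 ℤ.* C) ℤ.* ℤ.+ 1))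
fraction-identity = ℤ-Solver.solve-∀

∣s/N-[d+t/c-1]∣≤e/N : ∀ s n d t c .{{_ : NonZero c}} e →
  ∣ c * (s + suc n) - suc n * (c * d + t) ∣ ≤ c * e →
  ℚ.∣ (ℤ.+ s ℚ./ suc n) ℚ.- ((ℤ.+ d ℚ./ 1 ℚ.+ ℤ.+ t ℚ./ c) ℚ.- ℚ.1ℚ) ∣ ℚ.≤ ℤ.+ e ℚ./ suc n
∣s/N-[d+t/c-1]∣≤e/N s n d t c@(suc c′) e bound = ℚ.toℚᵘ-cancel-≤ (begin
  toℚᵘ ℚ.∣ x ℚ.- y ∣
    ≃⟨ ℚᵘ.≃-trans (ℚ.toℚᵘ-homo-∣-∣ (x ℚ.- y)) (ℚᵘ.∣-∣-cong (toℚᵘ-homo-minus x y)) ⟩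
  ℚᵘ.∣ toℚᵘ x ℚᵘ.- toℚᵘ y ∣
    ≃⟨ ℚᵘ.∣-∣-cong (ℚᵘ.+-cong (ℚ.toℚᵘ-fromℚᵘ xᵘ) (ℚᵘ.-‿cong {toℚᵘ y} {yᵘ} toℚᵘ-y)) ⟩
  ℚᵘ.∣ xᵘ ℚᵘ.- yᵘ ∣
    ≃⟨ ℚᵘ.∣-∣-cong {xᵘ ℚᵘ.- yᵘ} {Z ℚᵘ./ (c * N)}
         (ℚᵘ.*≡* (fraction-identity (ℤ.+ s) (ℤ.+ d) (ℤ.+ t) (ℤ.+ c) (ℤ.+ N))) ⟩
  ℚᵘ.∣ Z ℚᵘ./ (c * N) ∣
    ≤⟨ ℚᵘ.*≤* (subst₂ ℤ._≤_ (ℤ.pos-* ℤ.∣ Z ∣ N) (ℤ.pos-* e (c * N))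
         (ℤ.+≤+ (≤-trans (*-monoˡ-≤ N ∣Z∣≤) (≤-reflexive (e-regroup c e N))))) ⟩
  mkℚᵘ (ℤ.+ e) n
    ≃⟨ ℚ.toℚᵘ-fromℚᵘ (mkℚᵘ (ℤ.+ e) n) ⟨
  toℚᵘ (ℤ.+ e ℚ./ N) ∎)
  where
  open ℚᵘ.≤-Reasoning
  N = suc n
  x = ℤ.+ s ℚ./ N
  y = (ℤ.+ d ℚ./ 1 ℚ.+ ℤ.+ t ℚ./ c) ℚ.- ℚ.1ℚ
  xᵘ = mkℚᵘ (ℤ.+ s) n
  yᵘ = (mkℚᵘ (ℤ.+ d) 0 ℚᵘ.+ mkℚᵘ (ℤ.+ t) c′) ℚᵘ.- 1ℚᵘ
  toℚᵘ-y : toℚᵘ y ℚᵘ.≃ yᵘ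
  toℚᵘ-y = ℚᵘ.≃-trans (toℚᵘ-homo-minus (ℤ.+ d ℚ./ 1 ℚ.+ ℤ.+ t ℚ./ c) ℚ.1ℚ)
             (ℚᵘ.+-congˡ (ℚᵘ.- 1ℚᵘ) (ℚᵘ.≃-trans (ℚ.toℚᵘ-homo-+ (ℤ.+ d ℚ./ 1) (ℤ.+ t ℚ./ c))
               (ℚᵘ.+-cong (ℚ.toℚᵘ-fromℚᵘ (mkℚᵘ (ℤ.+ d) 0)) (ℚ.toℚᵘ-fromℚᵘ (mkℚᵘ (ℤ.+ t) c′)))))
  Z = ℤ.+ c ℤ.* (ℤ.+ s ℤ.+ ℤ.+ N) ℤ.- ℤ.+ N ℤ.* (ℤ.+ c ℤ.* ℤ.+ d ℤ.+ ℤ.+ t)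
  Z≡ : Z ≡ (c * (s + N)) ⊖ (N * (c * d + t))
  Z≡ = trans (cong₂ ℤ._-_ (sym cast₁) (sym cast₂)) (ℤ.m-n≡m⊖n (c * (s + N)) (N * (c * d + t)))
    where
    cast₁ : ℤ.+ (c * (s + N)) ≡ ℤ.+ c ℤ.* (ℤ.+ s ℤ.+ ℤ.+ N)
    cast₁ = trans (ℤ.pos-* c (s + N)) (cong (ℤ.+ c ℤ.*_) (ℤ.pos-+ s N))
    cast₂ : ℤ.+ (N * (c * d + t)) ≡ ℤ.+ N ℤ.* (ℤ.+ c ℤ.* ℤ.+ d ℤ.+ ℤ.+ t)
    cast₂ = trans (ℤ.pos-* N (c * d + t))
                  (cong (ℤ.+ N ℤ.*_) (trans (ℤ.pos-+ (c * d) t) (cong (ℤ._+ ℤ.+ t) (ℤ.pos-* c d))))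
  e-regroup : ∀ c e N → c * e * N ≡ e * (c * N)
  e-regroup = solve-∀
  ∣Z∣≤ : ℤ.∣ Z ∣ ≤ c * e
  ∣Z∣≤ = subst (_≤ c * e) (sym (trans (cong ℤ.∣_∣ Z≡) (∣m⊖n∣≡∣m-n∣ (c * (s + N)) (N * (c * d + t)))))
               bound

convergesTo-at-rate : ∀ (x : ℕ → ℚ) L (e : ℕ → ℕ) →
  (∀ n → ℚ.∣ x (suc n) ℚ.- L ∣ ℚ.≤ ℤ.+ e (suc n) ℚ./ suc n) →
  (∀ m → ∃[ N₀ ] ∀ N → N₀ ≤ N → m * e N < N) →
  ConvergesTo x L
convergesTo-at-rate x L e close rate (mkℚ (ℤ.+ zero) _ _) (ℚ.*<* (ℤ.+<+ ()))
convergesTo-at-rate x L e close rate (mkℚ -[1+ _ ]   _ _) (ℚ.*<* ())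
convergesTo-at-rate x L e close rate ε@(mkℚ +[1+ p ] q _) _ with rate (suc q)
... | N₀ , fast = N₀ , within
  where
  within : ∀ N → N₀ ≤ N → ℚ.∣ x N ℚ.- L ∣ ℚ.< ε
  within zero    N₀≤0 = ⊥-elim (n≮0 (fast 0 N₀≤0))
  within (suc n) N₀≤N = ℚ.≤-<-trans (close n) (ℚ.toℚᵘ-cancel-<
    (ℚᵘ.<-respˡ-≃ (ℚᵘ.≃-sym (ℚ.toℚᵘ-fromℚᵘ (mkℚᵘ (ℤ.+ e (suc n)) n)))
      (ℚᵘ.*<* (subst₂ ℤ._<_ (ℤ.pos-* (e (suc n)) (suc q)) (ℤ.pos-* (suc p) (suc n))
        (ℤ.+<+ (begin-strict
          e (suc n) * suc q   ≡⟨ *-comm (e (suc n)) (suc q) ⟩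
          suc q * e (suc n)   <⟨ fast (suc n) N₀≤N ⟩
          suc n               ≤⟨ m≤n*m (suc n) (suc p) ⟩
          suc p * suc n       ∎))))))
    where open ≤-Reasoning

averageErrorBound : ℕ → ℕ → ℕ
averageErrorBound k N = suc (⌈log₂ k ⌉ + suc ⌈log₂ N ⌉) * k

average-closedForm-bound : 1 ≤ k → ∀ n →
  ℚ.∣ average k (suc n) ℚ.- closedForm k ∣ ℚ.≤ ℤ.+ averageErrorBound k (suc n) ℚ./ suc n
average-closedForm-bound {k} 1≤k n =
  ∣s/N-[d+t/c-1]∣≤e/N (partialSum k N) n D (2 * k) (2 ^ D) {{m^n≢0 2 D}} (averageErrorBound k N)
    (partialSum-bound D (suc ⌈log₂ N ⌉) (n≤2^⌈log₂n⌉ k) (2^⌈log₂n⌉<2*n k 1≤k)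
      (m+n≤2^[i+suc[j]] D ⌈log₂ N ⌉ (n≤2^⌈log₂n⌉ k) (n≤2^⌈log₂n⌉ N)))
  where
  N = suc n
  D = ⌈log₂ k ⌉

averageErrorBound-sublinear : ∀ k m → ∃[ N₀ ] ∀ N → N₀ ≤ N → m * averageErrorBound k N < N
averageErrorBound-sublinear k m with log-sublinear (m * k) (⌈log₂ k ⌉ + 2)
... | N₀ , below = N₀ , λ N N₀≤N →
  subst (_< N) (sym (regroup m k ⌈log₂ k ⌉ ⌈log₂ N ⌉)) (below N N₀≤N)
  where regroup : ∀ m k D E → m * (suc (D + suc E) * k) ≡ m * k * (D + 2 + E)
        regroup = solve-∀

lemma23 : ∀ (k : ℕ) → 1 ≤ k → ConvergesTo (average k) (closedForm k)
lemma23 k 1≤k = convergesTo-at-rate (average k) (closedForm k) (averageErrorBound k)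
  (average-closedForm-bound 1≤k) (averageErrorBound-sublinear k)
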